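{- Let $(Q,\rightarrow)$ be a finite transition system, $\mathscr{R}$ a preorder on $Q$ and $\mathscr{P}\subseteq\mathscr{R}$ an equivalence relation whose blocks have fixed representatives, such that there is no $(\mathscr{P},\mathscr{R})$-splitter transition of type 1. Let $E$ be a block of $\mathscr{P}$ and $B$ a block of $\mathscr{R}$ with $E\rightarrow B$. Then $E.\mathit{rep}\in(\rightarrow_{\mathscr{R}}^{ -1}\circ\mathscr{R})(B)$.
   Context: Composition: $\mathscr{S}\circ\mathscr{R}=\{(x,y)\mid\exists z,(x,z)\in\mathscr{R},(z,y)\in\mathscr{S}\}$; $\mathscr{R}(X)=\{y\mid\exists x\in X,\ x\,\mathscr{R}\,y\}$. Blocks of a preorder $\mathscr{R}$: $[q]_{\mathscr{R}}=\{q'\mid q\,\mathscr{R}\,q'\wedge q'\,\mathscr{R}\,q\}$. A transition $q\rightarrow q'$ is $\mathscr{R}$-maximal ($q\rightarrow_{\mathscr{R}}q'$) if for all $q''$ with $q\rightarrow q''$ and $q'\,\mathscr{R}\,q''$ we have $q''\in[q']_{\mathscr{R}}$. Each block $E$ of $\mathscr{P}$ has a fixed representative $E.\mathit{rep}\in E$. $X\,\mathscr{R}\,Y$ means $(X\times Y)\cap\mathscr{R}\ne\emptyset$; $X\rightarrow Y$ means some $x\in X,y\in Y$ with $x\rightarrow y$. $\mathrm{RelCount}_{(\mathscr{P},\mathscr{R})}(E,B)=|\{E'\text{ block of }\mathscr{P}\mid E.\mathit{rep}\rightarrow E'\wedge B\,\mathscr{R}\,E'\}|$. A $(\mathscr{P},\mathscr{R})$-splitter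 transition of type 1 is a pair $(E,B)$ with $E$ a block of $\mathscr{P}$, $B$ a block of $\mathscr{R}$, $E\rightarrow B$ and $\mathrm{RelCount}_{(\mathscr{P},\mathscr{R})}(E,B)=0$. -}

module Defs where

open import Data.Nat using (ℕ)
open import Data.Fin using (Fin)
open import Data.Fin.Properties using (any?; _≟_)
open import Data.Product using (Σ; ∃; _×_; _,_)
open import Data.List using (List; length; filter)
open import Data.List using () renaming (allFin to allFinL)
open import Relation.Nullary using (Dec; yes; no; ¬_)
open import Relation.Nullary.Decidable using (_×-dec_)
open import Relation.Binary using (Rel; Decidable; IsPreorder; IsEquivalence)
open import Relation.Binary.PropositionalEquality using (_≡_)
open import Level using (0ℓ)

-- A finite transition system on Q = Fin n, a preorder R, an equivalence P ⊆ R
-- with fixed block representatives.  Relations are finite, hence decidable.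
record Setting (n : ℕ) : Set₁ where
  field
    _⟶_   : Rel (Fin n) 0ℓ
    _⟶?_  : Decidable _⟶_
    R     : Rel (Fin n) 0ℓ
    R?    : Decidable R
    R-pre : IsPreorder _≡_ R
    P     : Rel (Fin n) 0ℓ
    P?    : Decidable P
    P-eq  : IsEquivalence P
    P⊆R   : ∀ {x y} → P x y → R x y
    rep      : Fin n → Fin n
    rep-in   : ∀ q → P q (rep q)
    rep-fixed : ∀ {q q'} → P q q' → rep q ≡ rep q'

  _∈R[_] : Fin n → Fin n → Set
  x ∈R[ q ] = R q x × R x q

  _∈P[_] : Fin n → Fin n → Set
  x ∈P[ q ] = P q x × P x q

  _⟶PR_ : Fin n → Fin n → Set
  e ⟶PR b = Σ (Fin n) λ x → Σ (Fin n) λ y → x ∈P[ e ] × y ∈R[ b ] × x ⟶ y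

  ⟶Pblk : Fin n → Fin n → Set
  ⟶Pblk q e' = ∃ λ y → y ∈P[ e' ] × q ⟶ y

  RblkPblk : Fin n → Fin n → Set
  RblkPblk b e' = ∃ λ x → ∃ λ y → x ∈R[ b ] × y ∈P[ e' ] × R x y

  -- Blocks of P are counted via their (unique) representatives.
  RelCountPred : Fin n → Fin n → Fin n → Set
  RelCountPred e b q = rep q ≡ q × ⟶Pblk (rep e) q × RblkPblk b q

  RelCountPred? : ∀ e b q → Dec (RelCountPred e b q)
  RelCountPred? e b q =
    (rep q ≟ q) ×-dec
    (any? (λ y → (P? q y ×-dec P? y q) ×-dec (rep e ⟶? y)) ×-dec
     any? (λ x → any? (λ y → (R? b x ×-dec R? x b) ×-dec (P? q y ×-dec P? y q) ×-dec R? x y)))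

  RelCount : Fin n → Fin n → ℕ
  RelCount e b = length (filter (RelCountPred? e b) (allFinL n))

  Splitter1 : Fin n → Fin n → Set
  Splitter1 e b = e ⟶PR b × RelCount e b ≡ 0

  _⟶R_ : Fin n → Fin n → Set
  q ⟶R q' = q ⟶ q' × (∀ q'' → q ⟶ q'' → R q' q'' → q'' ∈R[ q' ])

  InInvMaxR : Fin n → Fin n → Set
  InInvMaxR b w = ∃ λ x → ∃ λ z → x ∈R[ b ] × R x z × w ⟶R z

module Submission where

-- Let E = [e]_P and B = [b]_R with E → B.  Since (E, B) is not
-- a splitter transition of type 1, RelCount(E, B) ≠ 0, so some P-block E'
-- satisfies  rep e → E'  and  B R E'.  Unfolding this yields a successor y
-- of rep e with  b R y.  Among the successors of rep e we then climb from y
-- to an R-maximal one w; finiteness of Q guarantees the climb terminates.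
-- Then  rep e →_R w  and  b R y R w,  i.e.  rep e ∈ (→_R⁻¹ ∘ R)(B).

open import Defs
open import Data.Nat using (ℕ)
open import Data.Fin using (Fin)
open import Data.Fin.Properties using (any?)
open import Data.Fin.Induction using (spo-noetherian)
open import Data.List using (List; []; _∷_; length; filter; allFin)
open import Data.List.Relation.Unary.All using (_∷_)
open import Data.List.Relation.Unary.All.Properties using (all-filter)
open import Data.Product using (∃; _×_; _,_)
open import Data.Empty using (⊥-elim)
open import Function using (flip)
open import Induction.WellFounded using (Acc; acc)
open import Relation.Nullary using (¬_; Dec; yes; no)
open import Relation.Nullary.Decidable using (_×-dec_; ¬?)
open import Relation.Unary using (Pred; Decidable)
open import Relation.Binary using (Rel; IsPreorder; IsStrictPartialOrder)
open import Relation.Binary.PropositionalEquality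
  using (_≡_; _≢_; refl; resp₂; isEquivalence)
open import Level using (0ℓ)

filter-witness : {A : Set} {S : Pred A 0ℓ} (S? : Decidable S) (xs : List A) →
                 length (filter S? xs) ≢ 0 → ∃ S
filter-witness S? xs nonzero with filter S? xs | all-filter S? xs
... | []    | _       = ⊥-elim (nonzero refl)
... | x ∷ _ | Sx ∷ _  = x , Sx

module FinitePreorder {n : ℕ} {R : Rel (Fin n) 0ℓ}
                      (R? : ∀ x y → Dec (R x y)) (R-pre : IsPreorder _≡_ R) where

  open IsPreorder R-pre using () renaming (refl to R-refl; trans to R-trans)

  _⊏_ : Rel (Fin n) 0ℓ
  x ⊏ y = R x y × ¬ R y x

  ⊏-isStrictPartialOrder : IsStrictPartialOrder _≡_ _⊏_
  ⊏-isStrictPartialOrder = record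
    { isEquivalence = isEquivalence
    ; irrefl        = λ { refl (_ , ¬Rxx) → ¬Rxx R-refl }
    ; trans         = λ (Rxy , ¬Ryx) (Ryz , ¬Rzy) →
                        R-trans Rxy Ryz , λ Rzx → ¬Rzy (R-trans Rzx Rxy)
    ; <-resp-≈      = resp₂ _⊏_
    }

  Maximal : Pred (Fin n) 0ℓ → Fin n → Set
  Maximal S w = ∀ q → S q → R w q → R q w

  -- Either nothing in S is strictly above z (then z itself is maximal), or we
  -- climb to such an element; the climb is well founded because ⊏ is
  -- Noetherian on the finite carrier.
  maximal-above : {S : Pred (Fin n) 0ℓ} → Decidable S →
                  ∀ z → S z → ∃ λ w → S w × R z w × Maximal S w
  maximal-above {S} S? z Sz = climb z Sz (spo-noetherian ⊏-isStrictPartialOrder z)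
    where
    climb : ∀ z → S z → Acc (flip _⊏_) z → ∃ λ w → S w × R z w × Maximal S w
    climb z Sz (acc above) with any? (λ q → S? q ×-dec (R? z q ×-dec ¬? (R? q z)))
    ... | yes (q , Sq , Rzq , ¬Rqz) =
          let (w , Sw , Rqw , max-w) = climb q Sq (above (Rzq , ¬Rqz))
          in  w , Sw , R-trans Rzq Rqw , max-w
    ... | no nothing-above = z , Sz , R-refl , z-maximal
          where
          z-maximal : Maximal S z
          z-maximal q Sq Rzq with R? q z
          ... | yes Rqz = Rqz
          ... | no ¬Rqz = ⊥-elim (nothing-above (q , Sq , Rzq , ¬Rqz))

module _ {n : ℕ} (St : Setting n) where
  open Setting St
  open IsPreorder R-pre using () renaming (refl to R-refl; trans to R-trans)

  -- A block counted by RelCount(E, B) provides a successor y of E.rep with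
  -- b R y:  b R x R y'' P q P y  along the witnesses, using P ⊆ R.
  counted-successor : ∀ {e b q} → RelCountPred e b q →
                      ∃ λ y → rep e ⟶ y × R b y
  counted-successor
    (_ , (y , (Pqy , _) , rep-e⟶y) , (x , y'' , (Rbx , _) , (_ , Py''q) , Rxy'')) =
    y , rep-e⟶y , R-trans Rbx (R-trans Rxy'' (R-trans (P⊆R Py''q) (P⊆R Pqy)))

  maximal-successor : ∀ {q w} → q ⟶ w →
                      FinitePreorder.Maximal R? R-pre (q ⟶_) w → q ⟶R w
  maximal-successor q⟶w max-w = q⟶w , λ q'' q⟶q'' Rwq'' → Rwq'' , max-w q'' q⟶q'' Rwq''

lemma4 : {n : ℕ} (S : Setting n) →
    let open Setting S in
    (∀ e b → ¬ Splitter1 e b) →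
    (e b : Fin n) → e ⟶PR b → InInvMaxR b (rep e)
lemma4 {n} St no-splitter e b e⟶b =
  let (_ , counted)            = filter-witness (RelCountPred? e b) (allFin n)
                                   (λ count≡0 → no-splitter e b (e⟶b , count≡0))
      (y , e⟶y , Rby)         = counted-successor St counted
      (w , e⟶w , Ryw , max-w) = maximal-above (rep e ⟶?_) y e⟶y
  in  b , w , (R-refl , R-refl) , R-trans Rby Ryw , maximal-successor St e⟶w max-w
  where
  open Setting St
  open IsPreorder R-pre using () renaming (refl to R-refl; trans to R-trans)
  open FinitePreorder R? R-pre using (maximal-above)
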